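{- Let $k$ be a positive integer and let $n>6k^2$. Let $T$ be a forest on $k$ vertices. If $F$ is a graph on $n$ vertices with minimum degree at least $2n/3$, then $F$ contains $n$ pairwise edge-disjoint copies of $T$ such that, for each vertex $v$ of $T$, the $n$ images of $v$ in these $n$ copies are pairwise distinct. In particular, each vertex of $F$ belongs to exactly $k$ of these copies.
   Context: A copy of $T$ in $F$ is a subgraph of $F$ isomorphic to $T$ together with an isomorphism from $T$; the image of a vertex $v$ of $T$ in a copy is the vertex of $F$ to which $v$ is mapped. -}

module Defs where

open import Data.Nat using (ℕ; zero; suc; _+_; _*_; _≤_; _<_; _≥_)
open import Data.Fin using (Fin; _≟_)
open import Data.Bool using (Bool; true; false; if_then_else_)
open import Data.List using (List; []; _∷_; length)
open import Data.List.Relation.Unary.Unique.Propositional using (Unique)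
open import Data.Product using (Σ; _×_; _,_; ∃-syntax)
open import Data.Sum using (_⊎_)
open import Data.Empty using (⊥)
open import Relation.Binary.PropositionalEquality using (_≡_; _≢_)
open import Relation.Nullary using (¬_; does)
open import Function.Definitions using (Injective)
open import Data.Fin.Properties using (any?)

record Graph (n : ℕ) : Set where
  field
    adj   : Fin n → Fin n → Bool
    sym   : ∀ u v → adj u v ≡ adj v u
    irrefl : ∀ v → adj v v ≡ false
open Graph public

Edge : ∀ {n} → Graph n → Fin n → Fin n → Set
Edge G u v = adj G u v ≡ true

count : ∀ {n} → (Fin n → Bool) → ℕ
count {zero} p = 0
count {suc n} p = (if p Fin.zero then 1 else 0) + count (λ i → p (Fin.suc i))

degree : ∀ {n} → Graph n → Fin n → ℕ
degree G v = count (adj G v)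

MinDegAtLeastTwoThirds : ∀ {n} → Graph n → Set
MinDegAtLeastTwoThirds {n} G = ∀ v → 2 * n ≤ 3 * degree G v

Path : ∀ {n} → Graph n → List (Fin n) → Set
Path G [] = Data.Unit.⊤ where import Data.Unit
Path G (x ∷ []) = Data.Unit.⊤ where import Data.Unit
Path G (x ∷ y ∷ xs) = Edge G x y × Path G (y ∷ xs)

last : ∀ {A : Set} → A → List A → A
last a [] = a
last a (x ∷ xs) = last x xs

IsCycle : ∀ {n} → Graph n → List (Fin n) → Set
IsCycle G [] = ⊥
IsCycle G (x ∷ xs) = 3 ≤ length (x ∷ xs) × Unique (x ∷ xs) × Path G (x ∷ xs) × Edge G (last x xs) x

IsForest : ∀ {n} → Graph n → Set
IsForest G = ∀ xs → ¬ IsCycle G xs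

-- A copy of T in F: an injective map of vertices sending edges of T to edges of F
-- (the copy is the subgraph formed by the images of the vertices and edges of T)
record Copy {k n : ℕ} (T : Graph k) (F : Graph n) : Set where
  field
    φ      : Fin k → Fin n
    inj    : Injective _≡_ _≡_ φ
    edges  : ∀ u v → Edge T u v → Edge F (φ u) (φ v)
open Copy public

UsesEdge : ∀ {k n} {T : Graph k} {F : Graph n} → Copy T F → Fin n → Fin n → Set
UsesEdge {T = T} c x y = ∃[ u ] ∃[ v ] (Edge T u v × φ c u ≡ x × φ c v ≡ y)

EdgeDisjoint : ∀ {k n} {T : Graph k} {F : Graph n} → Copy T F → Copy T F → Set
EdgeDisjoint c d = ∀ x y → UsesEdge c x y → ¬ UsesEdge d x y

inCopy : ∀ {k n} {T : Graph k} {F : Graph n} → Copy T F → Fin n → Bool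
inCopy c x = does (any? (λ v → φ c v ≟ x))

-- The n copies are built simultaneously, one vertex of T at a time.  A nonempty vertex set S of a
-- forest contains a vertex v with at most one neighbour p in S (otherwise a walk in T[S] that never
-- turns back would close a cycle), so T[S] can be grown by the leaf v.  The images f i of v in the
-- copies i must form a permutation of V(F) with f i outside copy i and, when p exists, f i joined to
-- the image of p in copy i by an edge no copy uses yet.  Every vertex of F lies in at most |S| copies
-- and meets at most 2|S| - 2 used edges, so in the bipartite graph of admissible pairs (i, f i) all
-- degrees are at least 2n/3 - 3k, and n > 6k² makes every row degree plus column degree at least
-- n + 4.  That is enough to extend a partial matching row by row, switching at most one earlier row,
-- while never letting two copies a, b take the same new edge (f a = image of p in b and vice versa).

module Submission where

open import Defs hiding (sym)
open import Data.Nat using (ℕ; zero; suc; _+_; _*_; _∸_; _≤_; _<_; z≤n; s≤s; _<?_; NonZero)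
open import Data.Nat.Properties hiding (_≟_)
open import Data.Nat.Tactic.RingSolver using (solve-∀)
open import Data.Fin using (Fin; _≟_; toℕ; fromℕ<) renaming (zero to fzero; suc to fsuc)
open import Data.Fin.Properties using (any?) renaming (suc-injective to fsuc-injective)
open import Data.Fin.Properties using ( toℕ-injective; toℕ-fromℕ<; toℕ<n; pigeonhole)
open import Data.Bool using (Bool; true; false; if_then_else_; _∧_; _∨_; not)
open import Data.Bool.Properties using (¬-not; ∨-zeroʳ; ∧-identityʳ)
import Data.Bool as Bool
open import Data.List using (List; []; _∷_; length)
open import Data.List.Relation.Unary.All using (All; []; _∷_)
open import Data.List.Relation.Unary.AllPairs using (AllPairs; []; _∷_)
open import Data.Product using (Σ; _×_; _,_; ∃-syntax; proj₁; proj₂)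
open import Data.Nat.Induction using (<-rec)
open import Data.Sum using (_⊎_; inj₁; inj₂)
open import Data.Empty using (⊥; ⊥-elim; ⊥-elim-irr)
open import Data.Vec.Functional using (updateAt)
open import Data.Vec.Functional.Properties using (updateAt-updates; updateAt-minimal)
open import Function.Base using (const)
open import Function.Definitions using (Injective)
open import Relation.Binary.PropositionalEquality
open import Relation.Nullary using (¬_; does; yes; no; Dec)
open import Relation.Nullary.Decidable using (_×-dec_; ¬?; dec-true; dec-false; decidable-stable)

-- Boolean predicates on Fin n and their counts

from-does : ∀ {P : Set} (d : Dec P) → does d ≡ true → P
from-does (yes p) _ = p

∧-elim : ∀ {a b} → a ∧ b ≡ true → a ≡ true × b ≡ true
∧-elim {true} {true} _ = refl , refl

∧-intro : ∀ {a b} → a ≡ true → b ≡ true → a ∧ b ≡ true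
∧-intro refl refl = refl

not-true : ∀ {a} → not a ≡ true → a ≡ false
not-true {false} _ = refl

not-false : ∀ {a} → a ≡ false → not a ≡ true
not-false refl = refl

_≡ᵇ_ : ∀ {n} → Fin n → Fin n → Bool
x ≡ᵇ y = does (x ≟ y)

≡ᵇ-refl : ∀ {n} (x : Fin n) → (x ≡ᵇ x) ≡ true
≡ᵇ-refl x = dec-true (x ≟ x) refl

≢⇒≡ᵇ-false : ∀ {n} {x y : Fin n} → x ≢ y → (x ≡ᵇ y) ≡ false
≢⇒≡ᵇ-false {x = x} {y} = dec-false (x ≟ y)

_∖_ : ∀ {n} → (Fin n → Bool) → Fin n → Fin n → Bool
(S ∖ y) z = S z ∧ not (z ≡ᵇ y)

∖-⊆ : ∀ {n} {S : Fin n → Bool} {y z} → (S ∖ y) z ≡ true → S z ≡ true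
∖-⊆ {S = S} {y} {z} e = proj₁ (∧-elim {S z} e)

∖-≢ : ∀ {n} {S : Fin n → Bool} {y z} → (S ∖ y) z ≡ true → z ≢ y
∖-≢ {S = S} {y} {z} e refl with () ← trans (sym (proj₂ (∧-elim {S z} e))) (cong not (≡ᵇ-refl z))

∈-∖ : ∀ {n} {S : Fin n → Bool} {y z} → S z ≡ true → z ≢ y → (S ∖ y) z ≡ true
∈-∖ Sz z≢y = ∧-intro Sz (not-false (≢⇒≡ᵇ-false z≢y))

Edge-sym : ∀ {n} (G : Graph n) {u v} → Edge G u v → Edge G v u
Edge-sym G {u} {v} e = trans (Graph.sym G v u) e

Edge-irrefl : ∀ {n} (G : Graph n) {v} → ¬ Edge G v v
Edge-irrefl G {v} e with () ← trans (sym e) (irrefl G v)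

count-≤ : ∀ {n} (p : Fin n → Bool) → count p ≤ n
count-≤ {zero} p = z≤n
count-≤ {suc n} p with p fzero
... | true = s≤s (count-≤ (λ i → p (fsuc i)))
... | false = m≤n⇒m≤1+n (count-≤ (λ i → p (fsuc i)))

count-cong : ∀ {n} {p q : Fin n → Bool} → (∀ i → p i ≡ q i) → count p ≡ count q
count-cong {zero} e = refl
count-cong {suc n} {p} {q} e rewrite e fzero = cong ((if q fzero then 1 else 0) +_) (count-cong (λ i → e (fsuc i)))

count-mono : ∀ {n} {p q : Fin n → Bool} → (∀ i → p i ≡ true → q i ≡ true) → count p ≤ count q
count-mono {zero} h = z≤n
count-mono {suc n} {p} {q} h with p fzero in e1 | q fzero in e2
... | true | true = s≤s (count-mono (λ i → h (fsuc i)))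
... | true | false with () ← trans (sym (h fzero e1)) e2
... | false | true = m≤n⇒m≤1+n (count-mono (λ i → h (fsuc i)))
... | false | false = count-mono (λ i → h (fsuc i))

count-true : ∀ n → count {n} (λ _ → true) ≡ n
count-true zero = refl
count-true (suc n) = cong suc (count-true n)

count-false : ∀ {n} {p : Fin n → Bool} → (∀ i → p i ≡ false) → count p ≡ 0
count-false {zero} h = refl
count-false {suc n} {p} h rewrite h fzero = count-false (λ i → h (fsuc i))

count>0⇒∃ : ∀ {n} (p : Fin n → Bool) → 0 < count p → ∃[ i ] p i ≡ true
count>0⇒∃ {suc n} p h with p fzero in e
... | true = fzero , e
... | false with i , q ← count>0⇒∃ (λ i → p (fsuc i)) h = fsuc i , q

count-∧-∨ : ∀ {n} (p q : Fin n → Bool) →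
  count p + count q ≡ count (λ i → p i ∧ q i) + count (λ i → p i ∨ q i)
count-∧-∨ {zero} p q = refl
count-∧-∨ {suc n} p q with p fzero | q fzero | count-∧-∨ (λ i → p (fsuc i)) (λ i → q (fsuc i))
... | true | true | ih = cong suc (trans (+-suc _ _) (trans (cong suc ih) (sym (+-suc _ _))))
... | true | false | ih = trans (cong suc ih) (sym (+-suc _ _))
... | false | true | ih = trans (+-suc _ _) (trans (cong suc ih) (sym (+-suc _ _)))
... | false | false | ih = ih

count-∨ : ∀ {n} (p q : Fin n → Bool) → count (λ i → p i ∨ q i) ≤ count p + count q
count-∨ p q = subst (count (λ i → p i ∨ q i) ≤_) (sym (count-∧-∨ p q)) (m≤n+m _ _)

count-∧ : ∀ {n} (p q : Fin n → Bool) {r : Fin n → Bool} → (∀ i → (p i ∨ q i) ≡ true → r i ≡ true) →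
  count p + count q ≤ count (λ i → p i ∧ q i) + count r
count-∧ p q {r} p∨q⇒r =
  subst (_≤ count (λ i → p i ∧ q i) + count r) (sym (count-∧-∨ p q)) (+-monoʳ-≤ _ (count-mono p∨q⇒r))

count-not : ∀ {n} (p : Fin n → Bool) → count p + count (λ i → not (p i)) ≡ n
count-not {zero} p = refl
count-not {suc n} p with p fzero | count-not (λ i → p (fsuc i))
... | true | ih = cong suc ih
... | false | ih = trans (+-suc _ _) (cong suc ih)

count-≤1 : ∀ {n} (p : Fin n → Bool) → (∀ i j → p i ≡ true → p j ≡ true → i ≡ j) → count p ≤ 1
count-≤1 {zero} p h = z≤n
count-≤1 {suc n} p h with p fzero in e
... | true = s≤s (≤-reflexive (count-false others))
  where
  others : ∀ i → p (fsuc i) ≡ false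
  others i with p (fsuc i) in e′
  ... | true with () ← h fzero (fsuc i) e e′
  ... | false = refl
... | false = count-≤1 _ (λ i j a b → fsuc-injective (h (fsuc i) (fsuc j) a b))

count-remove : ∀ {n} (q : Fin n → Bool) (y : Fin n) → q y ≡ true → count q ≡ suc (count (q ∖ y))
count-remove {suc n} q fzero e rewrite e = cong suc (count-cong (λ i → sym (∧-identityʳ (q (fsuc i)))))
count-remove {suc n} q (fsuc y) e with q fzero | count-remove (λ i → q (fsuc i)) y e
... | true | ih = cong suc ih
... | false | ih = ih

∃⇒count>0 : ∀ {n} (p : Fin n → Bool) i → p i ≡ true → 0 < count p
∃⇒count>0 p i pi = subst (0 <_) (sym (count-remove p i pi)) (s≤s z≤n)

count-injection : ∀ {n m} (p : Fin n → Bool) (q : Fin m → Bool)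
  (f : ∀ i → p i ≡ true → Fin m) →
  (∀ i (e : p i ≡ true) → q (f i e) ≡ true) →
  (∀ i j (a : p i ≡ true) (b : p j ≡ true) → f i a ≡ f j b → i ≡ j) →
  count p ≤ count q
count-injection {zero} p q f hq hi = z≤n
count-injection {suc n} {m} p q f hq hi with p fzero in e0
... | false = count-injection (λ i → p (fsuc i)) q (λ i → f (fsuc i)) (λ i → hq (fsuc i))
               (λ i j a b eq → fsuc-injective (hi (fsuc i) (fsuc j) a b eq))
... | true = subst (suc (count (λ i → p (fsuc i))) ≤_) (sym (count-remove q y (hq fzero e0)))
               (s≤s (count-injection (λ i → p (fsuc i)) (q ∖ y)
                 (λ i → f (fsuc i)) avoids-y
                 (λ i j a b eq → fsuc-injective (hi (fsuc i) (fsuc j) a b eq))))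
  where
  y : Fin m
  y = f fzero e0
  avoids-y : ∀ i (e : p (fsuc i) ≡ true) → (q (f (fsuc i) e) ∧ not (f (fsuc i) e ≡ᵇ y)) ≡ true
  avoids-y i e rewrite hq (fsuc i) e with f (fsuc i) e ≟ y
  ... | no _ = refl
  ... | yes eq with () ← hi (fsuc i) fzero e e0 eq

_<ᵇ_ : ∀ {n} → Fin n → ℕ → Bool
j <ᵇ m = does (toℕ j <? m)

count-<ᵇ : ∀ {n} m → m ≤ n → count {n} (_<ᵇ m) ≡ m
count-<ᵇ {n} zero _ = count-false {n} (λ i → dec-false (toℕ i <? 0) (λ ()))
count-<ᵇ {suc n} (suc m) (s≤s m≤n) = cong suc (count-<ᵇ {n} m m≤n)

count-partition : ∀ {n} (p q : Fin n → Bool) →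
  count p ≤ count (λ x → p x ∧ not (q x)) + count (λ x → p x ∧ q x)
count-partition p q = ≤-trans (count-mono covered) (count-∨ (λ x → p x ∧ not (q x)) (λ x → p x ∧ q x))
  where
  covered : ∀ x → p x ≡ true → ((p x ∧ not (q x)) ∨ (p x ∧ q x)) ≡ true
  covered x e rewrite e with q x
  ... | true = refl
  ... | false = refl

count-split : ∀ {n} (p q : Fin n → Bool) → count p ≤ count (λ i → p i ∧ not (q i)) + count q
count-split p q =
  ≤-trans (count-partition p q) (+-monoʳ-≤ _ (count-mono {p = λ i → p i ∧ q i} (λ i e → proj₂ (∧-elim e))))

injective⇒surjective : ∀ {n} (f : Fin n → Fin n) → (∀ {a b} → f a ≡ f b → a ≡ b) → ∀ y → ∃[ i ] f i ≡ y
injective⇒surjective {n} f f-inj y with any? (λ i → f i ≟ y)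
... | yes hit = hit
... | no miss = ⊥-elim (<-irrefl refl (begin-strict
      n                                 ≡⟨ sym (count-true n) ⟩
      count {n} (λ _ → true)            ≤⟨ count-injection _ _ (λ i _ → f i) avoids-y (λ i j _ _ → f-inj) ⟩
      count ((λ _ → true) ∖ y)          <⟨ ≤-reflexive (sym (count-remove (λ _ → true) y refl)) ⟩
      count {n} (λ _ → true)            ≡⟨ count-true n ⟩
      n                                 ∎))
  where
  open ≤-Reasoning
  avoids-y : ∀ i → true ≡ true → ((λ _ → true) ∖ y) (f i) ≡ true
  avoids-y i _ = not-false (≢⇒≡ᵇ-false (λ fi≡y → miss (i , fi≡y)))

count≤count-∘ : ∀ {n} (f : Fin n → Fin n) → (∀ {a b} → f a ≡ f b → a ≡ b) → (q : Fin n → Bool) →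
  count q ≤ count (λ i → q (f i))
count≤count-∘ f f-inj q = count-injection q (λ i → q (f i)) (λ y _ → preimage y)
  (λ y e → subst (λ z → q z ≡ true) (sym (f∘preimage y)) e)
  (λ y y′ _ _ eq → trans (sym (f∘preimage y)) (trans (cong f eq) (f∘preimage y′)))
  where
  preimage : Fin _ → Fin _
  preimage y = proj₁ (injective⇒surjective f f-inj y)
  f∘preimage : ∀ y → f (preimage y) ≡ y
  f∘preimage y = proj₂ (injective⇒surjective f f-inj y)

6k²-bound : ∀ k t n → t + 2 ≤ k → 6 * (k * k) < n → 18 * t + 12 ≤ n
6k²-bound k t n t+2≤k 6k²<n = begin
  18 * t + 12                                  ≤⟨ m≤m+n _ _ ⟩
  (18 * t + 12) + (6 * (t * t) + 6 * t + 12)   ≡⟨ expand t ⟩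
  6 * ((t + 2) * (t + 2))                      ≤⟨ *-monoʳ-≤ 6 (*-mono-≤ t+2≤k t+2≤k) ⟩
  6 * (k * k)                                  ≤⟨ <⇒≤ 6k²<n ⟩
  n                                            ∎
  where
  open ≤-Reasoning
  expand : ∀ t → (18 * t + 12) + (6 * (t * t) + 6 * t + 12) ≡ 6 * ((t + 2) * (t + 2))
  expand = solve-∀

degree-sum-from-thirds : ∀ n t {dA dB} rA cA → 2 * n ≤ 3 * dA → 2 * n ≤ 3 * dB →
  dA ≤ rA + 3 * t → dB ≤ cA + 3 * t → 18 * t + 12 ≤ n → n + 4 ≤ rA + cA
degree-sum-from-thirds n t {dA} {dB} rA cA 2n≤3dA 2n≤3dB dA≤ dB≤ big =
  *-cancelˡ-≤ 3 (+-cancelˡ-≤ (18 * t) _ _ (begin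
    18 * t + 3 * (n + 4)                ≡⟨ e₁ t n ⟩
    3 * n + (18 * t + 12)               ≤⟨ +-monoʳ-≤ (3 * n) big ⟩
    3 * n + n                           ≡⟨ e₂ n ⟩
    2 * n + 2 * n                       ≤⟨ +-mono-≤ 2n≤3dA 2n≤3dB ⟩
    3 * dA + 3 * dB                     ≤⟨ +-mono-≤ (*-monoʳ-≤ 3 dA≤) (*-monoʳ-≤ 3 dB≤) ⟩
    3 * (rA + 3 * t) + 3 * (cA + 3 * t) ≡⟨ e₃ rA cA t ⟩
    18 * t + 3 * (rA + cA)              ∎))
  where
  open ≤-Reasoning
  e₁ : ∀ t n → 18 * t + 3 * (n + 4) ≡ 3 * n + (18 * t + 12)
  e₁ = solve-∀
  e₂ : ∀ n → 3 * n + n ≡ 2 * n + 2 * n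
  e₂ = solve-∀
  e₃ : ∀ rA cA t → 3 * (rA + 3 * t) + 3 * (cA + 3 * t) ≡ 18 * t + 3 * (rA + cA)
  e₃ = solve-∀

degree-sum-from-complements : ∀ n t {rA cA} → n ≤ rA + suc t → n ≤ cA + suc t → 18 * t + 12 ≤ n →
  n + 4 ≤ rA + cA
degree-sum-from-complements n t {rA} {cA} n≤rA n≤cA big = +-cancelˡ-≤ (2 * suc t) _ _ (begin
  2 * suc t + (n + 4)           ≡⟨ e₁ t n ⟩
  n + (2 * t + 6)               ≤⟨ +-monoʳ-≤ n (+-mono-≤ (*-monoˡ-≤ t (m≤m+n 2 16)) (m≤m+n 6 6)) ⟩
  n + (18 * t + 12)             ≤⟨ +-monoʳ-≤ n big ⟩
  n + n                         ≤⟨ +-mono-≤ n≤rA n≤cA ⟩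
  (rA + suc t) + (cA + suc t)   ≡⟨ e₂ rA cA t ⟩
  2 * suc t + (rA + cA)         ∎)
  where
  open ≤-Reasoning
  e₁ : ∀ t n → 2 * suc t + (n + 4) ≡ n + (2 * t + 6)
  e₁ = solve-∀
  e₂ : ∀ rA cA t → (rA + suc t) + (cA + suc t) ≡ 2 * suc t + (rA + cA)
  e₂ = solve-∀

-- Swap-free perfect matchings

-- In the application c i is
-- the image of the parent in copy i, so f a = c b together with f b = c a would put the same new edge
-- into the copies a and b.
module _ {n : ℕ} (A : Fin n → Fin n → Bool) (c : Fin n → Fin n)
         (c-inj : ∀ {a b} → c a ≡ c b → a ≡ b) (A-c : ∀ i → A i (c i) ≡ false) where

  record PartialMatching (m : ℕ) (g : Fin n → Fin n) : Set where
    field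
      adjacent : ∀ j → toℕ j < m → A j (g j) ≡ true
      injective : ∀ a b → toℕ a < m → toℕ b < m → g a ≡ g b → a ≡ b
      no-swap : ∀ a b → toℕ a < m → toℕ b < m → g a ≡ c b → g b ≡ c a → ⊥

  A⇒≢c : ∀ {i y} → A i y ≡ true → y ≢ c i
  A⇒≢c {i} e refl with () ← trans (sym e) (A-c i)

  module Extend (degrees : ∀ i x → n + 4 ≤ count (A i) + count (λ j → A j x))
                (m : ℕ) (m<n : m < n) (g : Fin n → Fin n) (pm : PartialMatching m g) where
    open PartialMatching pm

    new : Fin n
    new = fromℕ< m<n

    old≢new : ∀ {a : Fin n} → toℕ a < m → a ≢ new
    old≢new a<m refl = <-irrefl (toℕ-fromℕ< m<n) a<m

    data Row (a : Fin n) : Set where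
      is-new : a ≡ new → Row a
      is-old : toℕ a < m → Row a

    row : ∀ a → toℕ a < suc m → Row a
    row a a<1+m with m<1+n⇒m<n∨m≡n a<1+m
    ... | inj₁ a<m = is-old a<m
    ... | inj₂ a≡m = is-new (toℕ-injective (trans a≡m (sym (toℕ-fromℕ< m<n))))

    old : Fin n → Bool
    old j = j <ᵇ m

    count-old : count old ≡ m
    count-old = count-<ᵇ m (<⇒≤ m<n)

    taken? : ∀ y → Dec (∃[ j ] toℕ j < m × g j ≡ y)
    taken? y = any? λ j → (toℕ j <? m) ×-dec (g j ≟ y)

    taken : Fin n → Bool
    taken y = does (taken? y)

    taken-by : ∀ {y} → taken y ≡ true → ∃[ j ] toℕ j < m × g j ≡ y
    taken-by {y} = from-does (taken? y)

    taken-intro : ∀ {j y} → toℕ j < m → g j ≡ y → taken y ≡ true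
    taken-intro {j} {y} j<m gj≡y = dec-true (taken? y) (j , j<m , gj≡y)

    swaps-with-new? : ∀ y → Dec (∃[ l ] toℕ l < m × y ≡ c l × g l ≡ c new)
    swaps-with-new? y = any? λ l → (toℕ l <? m) ×-dec ((y ≟ c l) ×-dec (g l ≟ c new))

    swaps-with-new : Fin n → Bool
    swaps-with-new y = does (swaps-with-new? y)

    direct : Fin n → Bool
    direct y = A new y ∧ (not (taken y) ∧ not (swaps-with-new y))

    match-directly : ∀ y → A new y ≡ true → taken y ≡ false → swaps-with-new y ≡ false →
                     Σ (Fin n → Fin n) (PartialMatching (suc m))
    match-directly y Ay free no-swap-y =
      g′ , record { adjacent = adjacent′ ; injective = injective′ ; no-swap = no-swap′ }
      where
      g′ : Fin n → Fin n
      g′ = updateAt g new (const y)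
      g′-new : g′ new ≡ y
      g′-new = updateAt-updates new g
      g′-old : ∀ {a} → toℕ a < m → g′ a ≡ g a
      g′-old {a} a<m = updateAt-minimal a new g (old≢new a<m)
      no-swap-with-new : ∀ {b} → toℕ b < m → y ≡ c b → g b ≡ c new → ⊥
      no-swap-with-new {b} b<m e₁ e₂ with () ← trans (sym (dec-true (swaps-with-new? y) (b , b<m , e₁ , e₂))) no-swap-y
      untaken : ∀ {b} → toℕ b < m → g b ≢ y
      untaken b<m e with () ← trans (sym (taken-intro b<m e)) free
      adjacent′ : ∀ j → toℕ j < suc m → A j (g′ j) ≡ true
      adjacent′ j j< with row j j<
      ... | is-new refl rewrite g′-new = Ay
      ... | is-old j<m rewrite g′-old j<m = adjacent j j<m
      injective′ : ∀ a b → toℕ a < suc m → toℕ b < suc m → g′ a ≡ g′ b → a ≡ b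
      injective′ a b a< b< e with row a a< | row b b<
      ... | is-new refl | is-new refl = refl
      ... | is-new refl | is-old b<m rewrite g′-new | g′-old b<m = ⊥-elim (untaken b<m (sym e))
      ... | is-old a<m | is-new refl rewrite g′-new | g′-old a<m = ⊥-elim (untaken a<m e)
      ... | is-old a<m | is-old b<m rewrite g′-old a<m | g′-old b<m = injective a b a<m b<m e
      no-swap′ : ∀ a b → toℕ a < suc m → toℕ b < suc m → g′ a ≡ c b → g′ b ≡ c a → ⊥
      no-swap′ a b a< b< e₁ e₂ with row a a< | row b b<
      ... | is-new refl | is-new refl rewrite g′-new = A⇒≢c Ay e₁
      ... | is-new refl | is-old b<m rewrite g′-new | g′-old b<m = no-swap-with-new b<m e₁ e₂
      ... | is-old a<m | is-new refl rewrite g′-new | g′-old a<m = no-swap-with-new a<m e₂ e₁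
      ... | is-old a<m | is-old b<m rewrite g′-old a<m | g′-old b<m = no-swap a b a<m b<m e₁ e₂

    module Switching (x j : Fin n) (free : taken x ≡ false) (j<m : toℕ j < m)
                     (A-new : A new (g j) ≡ true) (A-j : A j x ≡ true)
                     (new-swap-free : ∀ {l} → toℕ l < m → g l ≡ c new → g j ≡ c l → ⊥)
                     (j-swap-free : ∀ {l} → x ≡ c l → g l ≡ c j → ⊥) where
      j≢new : j ≢ new
      j≢new = old≢new j<m
      g′ : Fin n → Fin n
      g′ = updateAt (updateAt g j (const x)) new (const (g j))
      g′-new : g′ new ≡ g j
      g′-new = updateAt-updates new (updateAt g j (const x))
      g′-j : g′ j ≡ x
      g′-j = trans (updateAt-minimal j new (updateAt g j (const x)) j≢new) (updateAt-updates j g)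
      g′-other : ∀ {l} → toℕ l < m → l ≢ j → g′ l ≡ g l
      g′-other {l} l<m l≢j =
        trans (updateAt-minimal l new (updateAt g j (const x)) (old≢new l<m)) (updateAt-minimal l j g l≢j)
      untaken : ∀ {b} → toℕ b < m → g b ≢ x
      untaken b<m e with () ← trans (sym (taken-intro b<m e)) free

      data Row′ (a : Fin n) : Set where
        is-new : a ≡ new → Row′ a
        is-j : a ≡ j → Row′ a
        is-other : toℕ a < m → a ≢ j → Row′ a

      row′ : ∀ a → toℕ a < suc m → Row′ a
      row′ a a< with row a a<
      ... | is-new e = is-new e
      ... | is-old a<m with a ≟ j
      ... | yes e = is-j e
      ... | no ne = is-other a<m ne

      adjacent′ : ∀ a → toℕ a < suc m → A a (g′ a) ≡ true
      adjacent′ a a< with row′ a a<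
      ... | is-new refl rewrite g′-new = A-new
      ... | is-j refl rewrite g′-j = A-j
      ... | is-other a<m a≢j rewrite g′-other a<m a≢j = adjacent a a<m

      injective′ : ∀ a b → toℕ a < suc m → toℕ b < suc m → g′ a ≡ g′ b → a ≡ b
      injective′ a b a< b< e with row′ a a< | row′ b b<
      ... | is-new refl | is-new refl = refl
      ... | is-j refl | is-j refl = refl
      ... | is-new refl | is-j refl rewrite g′-new | g′-j = ⊥-elim (untaken j<m e)
      ... | is-j refl | is-new refl rewrite g′-new | g′-j = ⊥-elim (untaken j<m (sym e))
      ... | is-new refl | is-other b<m b≢j rewrite g′-new | g′-other b<m b≢j = ⊥-elim (b≢j (sym (injective j b j<m b<m e)))
      ... | is-other a<m a≢j | is-new refl rewrite g′-new | g′-other a<m a≢j = ⊥-elim (a≢j (injective a j a<m j<m e))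
      ... | is-j refl | is-other b<m b≢j rewrite g′-j | g′-other b<m b≢j = ⊥-elim (untaken b<m (sym e))
      ... | is-other a<m a≢j | is-j refl rewrite g′-j | g′-other a<m a≢j = ⊥-elim (untaken a<m e)
      ... | is-other a<m a≢j | is-other b<m b≢j rewrite g′-other a<m a≢j | g′-other b<m b≢j = injective a b a<m b<m e

      no-swap′ : ∀ a b → toℕ a < suc m → toℕ b < suc m → g′ a ≡ c b → g′ b ≡ c a → ⊥
      no-swap′ a b a< b< e₁ e₂ with row′ a a< | row′ b b<
      ... | is-new refl | is-new refl rewrite g′-new = A⇒≢c A-new e₁
      ... | is-j refl | is-j refl rewrite g′-j = A⇒≢c A-j e₁
      ... | is-new refl | is-j refl rewrite g′-new | g′-j = A⇒≢c (adjacent j j<m) e₁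
      ... | is-j refl | is-new refl rewrite g′-new | g′-j = A⇒≢c (adjacent j j<m) e₂
      ... | is-new refl | is-other b<m b≢j rewrite g′-new | g′-other b<m b≢j = new-swap-free b<m e₂ e₁
      ... | is-other a<m a≢j | is-new refl rewrite g′-new | g′-other a<m a≢j = new-swap-free a<m e₁ e₂
      ... | is-j refl | is-other b<m b≢j rewrite g′-j | g′-other b<m b≢j = j-swap-free e₁ e₂
      ... | is-other a<m a≢j | is-j refl rewrite g′-j | g′-other a<m a≢j = j-swap-free e₂ e₁
      ... | is-other a<m a≢j | is-other b<m b≢j rewrite g′-other a<m a≢j | g′-other b<m b≢j = no-swap a b a<m b<m e₁ e₂

      switched : Σ (Fin n → Fin n) (PartialMatching (suc m))
      switched = g′ , record { adjacent = adjacent′ ; injective = injective′ ; no-swap = no-swap′ }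

    count-taken : count taken ≤ m
    count-taken = subst (count taken ≤_) count-old
      (count-injection taken old (λ y e → proj₁ (taken-by e))
        (λ y e → dec-true (toℕ (proj₁ (taken-by e)) <? m) (proj₁ (proj₂ (taken-by e))))
        (λ y y′ a b eq → trans (sym (proj₂ (proj₂ (taken-by a)))) (trans (cong g eq) (proj₂ (proj₂ (taken-by b))))))

    untaken-column : ∃[ x ] taken x ≡ false
    untaken-column with count>0⇒∃ (λ y → not (taken y)) (+-cancelˡ-< m 0 _ (begin-strict
        m + 0                              ≡⟨ +-identityʳ m ⟩
        m                                  <⟨ m<n ⟩
        n                                  ≡⟨ sym (count-not taken) ⟩
        count taken + count (λ y → not (taken y)) ≤⟨ +-monoˡ-≤ _ count-taken ⟩
        m + count (λ y → not (taken y))    ∎))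
      where open ≤-Reasoning
    ... | x , e = x , not-true e

    module NoDirectChoice (no-direct : ∀ y → direct y ≡ false) (x : Fin n) (free : taken x ≡ false) where

      feeds-new : Fin n → Bool
      feeds-new j = old j ∧ A new (g j)

      reaches-x : Fin n → Bool
      reaches-x j = old j ∧ A j x

      count-swaps-with-new : count swaps-with-new ≤ 1
      count-swaps-with-new = count-≤1 swaps-with-new λ y y′ a b →
        let (l , l<m , y≡cl , gl≡) = from-does (swaps-with-new? y) a
            (l′ , l′<m , y′≡cl′ , gl′≡) = from-does (swaps-with-new? y′) b
        in trans y≡cl (trans (cong c (injective l l′ l<m l′<m (trans gl≡ (sym gl′≡)))) (sym y′≡cl′))

      neighbour⇒taken : ∀ y → A new y ≡ true → swaps-with-new y ≡ false → taken y ≡ true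
      neighbour⇒taken y a no-swap-y with taken y in e
      ... | true = refl
      ... | false with () ← trans (sym (no-direct y)) (∧-intro a (∧-intro (not-false e) (not-false no-swap-y)))

      count-new≤ : count (A new) ≤ count feeds-new + 1
      count-new≤ = ≤-trans (count-split (A new) swaps-with-new) (+-mono-≤ into-feeds count-swaps-with-new)
        where
        owner : ∀ y → (A new y ∧ not (swaps-with-new y)) ≡ true → ∃[ j ] toℕ j < m × g j ≡ y
        owner y e = taken-by (neighbour⇒taken y (proj₁ (∧-elim e)) (not-true (proj₂ (∧-elim e))))
        into-feeds : count (λ y → A new y ∧ not (swaps-with-new y)) ≤ count feeds-new
        into-feeds = count-injection _ feeds-new (λ y e → proj₁ (owner y e))
          (λ y e → let (j , j<m , gj≡y) = owner y e in
                   ∧-intro (dec-true (toℕ j <? m) j<m) (subst (λ z → A new z ≡ true) (sym gj≡y) (proj₁ (∧-elim e))))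
          (λ y y′ a b eq → trans (sym (proj₂ (proj₂ (owner y a)))) (trans (cong g eq) (proj₂ (proj₂ (owner y′ b)))))

      count-x+m≤ : count (λ j → A j x) + m ≤ count reaches-x + n
      count-x+m≤ = begin
        count (λ j → A j x) + m                                ≤⟨ +-monoˡ-≤ m (count-split (λ j → A j x) (λ j → not (old j))) ⟩
        count (λ j → A j x ∧ not (not (old j))) + count (λ j → not (old j)) + m
                                                                ≤⟨ +-monoˡ-≤ m (+-monoˡ-≤ _ (count-mono into-reaches)) ⟩
        count reaches-x + count (λ j → not (old j)) + m         ≡⟨ +-assoc (count reaches-x) _ m ⟩
        count reaches-x + (count (λ j → not (old j)) + m)       ≡⟨ cong (count reaches-x +_) rest ⟩
        count reaches-x + n                                      ∎
        where
        open ≤-Reasoning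
        into-reaches : ∀ j → (A j x ∧ not (not (old j))) ≡ true → reaches-x j ≡ true
        into-reaches j e with A j x | old j
        into-reaches j e | true | true = refl
        rest : count (λ j → not (old j)) + m ≡ n
        rest = trans (+-comm _ m) (trans (cong (_+ count (λ j → not (old j))) (sym count-old)) (count-not old))

      count-feeds+reaches≤ : count feeds-new + count reaches-x ≤ count (λ j → feeds-new j ∧ reaches-x j) + m
      count-feeds+reaches≤ =
        subst (count feeds-new + count reaches-x ≤_) (cong (count (λ j → feeds-new j ∧ reaches-x j) +_) count-old)
          (count-∧ feeds-new reaches-x both-old)
        where
        both-old : ∀ j → (feeds-new j ∨ reaches-x j) ≡ true → old j ≡ true
        both-old j e with old j
        ... | true = refl
        both-old j () | false

      new-would-swap? : ∀ j → Dec (∃[ l ] toℕ l < m × g l ≡ c new × g j ≡ c l)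
      new-would-swap? j = any? λ l → (toℕ l <? m) ×-dec ((g l ≟ c new) ×-dec (g j ≟ c l))

      new-would-swap : Fin n → Bool
      new-would-swap j = old j ∧ does (new-would-swap? j)

      j-would-swap? : ∀ j → Dec (∃[ l ] x ≡ c l × g l ≡ c j)
      j-would-swap? j = any? λ l → (x ≟ c l) ×-dec (g l ≟ c j)

      j-would-swap : Fin n → Bool
      j-would-swap j = does (j-would-swap? j)

      count-new-would-swap : count new-would-swap ≤ 1
      count-new-would-swap = count-≤1 new-would-swap λ j j′ a b →
        let (j-old , wa) = ∧-elim a
            (j′-old , wb) = ∧-elim b
            (l , l<m , gl≡ , gj≡) = from-does (new-would-swap? j) wa
            (l′ , l′<m , gl′≡ , gj′≡) = from-does (new-would-swap? j′) wb
            l≡l′ = injective l l′ l<m l′<m (trans gl≡ (sym gl′≡))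
        in injective j j′ (from-does (toℕ j <? m) j-old) (from-does (toℕ j′ <? m) j′-old)
             (trans gj≡ (trans (cong c l≡l′) (sym gj′≡)))

      count-j-would-swap : count j-would-swap ≤ 1
      count-j-would-swap = count-≤1 j-would-swap λ j j′ a b →
        let (l , x≡cl , gl≡cj) = from-does (j-would-swap? j) a
            (l′ , x≡cl′ , gl′≡cj′) = from-does (j-would-swap? j′) b
            l≡l′ = c-inj (trans (sym x≡cl) x≡cl′)
        in c-inj (trans (sym gl≡cj) (trans (cong g l≡l′) gl′≡cj′))

      both : Fin n → Bool
      both j = feeds-new j ∧ reaches-x j

      switchable : Fin n → Bool
      switchable j = (both j ∧ not (new-would-swap j)) ∧ not (j-would-swap j)

      count-both≤ : count both ≤ count switchable + 2
      count-both≤ = begin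
        count both                                                  ≤⟨ count-split both new-would-swap ⟩
        count (λ j → both j ∧ not (new-would-swap j)) + count new-would-swap
          ≤⟨ +-mono-≤ (count-split (λ j → both j ∧ not (new-would-swap j)) j-would-swap) count-new-would-swap ⟩
        count switchable + count j-would-swap + 1                   ≤⟨ +-monoˡ-≤ 1 (+-monoʳ-≤ (count switchable) count-j-would-swap) ⟩
        count switchable + 1 + 1                                    ≡⟨ +-assoc (count switchable) 1 1 ⟩
        count switchable + 2                                        ∎
        where open ≤-Reasoning

      -- All neighbours of new but at most one are taken, so at least three old rows j have A new (g j)
      -- and A j x; at most two of them would create a swap.
      switchable-row : ∃[ j ] switchable j ≡ true
      switchable-row = count>0⇒∃ switchable
        (slack count-new≤ count-x+m≤ count-feeds+reaches≤ count-both≤ (degrees new x))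
        where
        slack : ∀ {d d′ P Q PQ R} → d ≤ P + 1 → d′ + m ≤ Q + n → P + Q ≤ PQ + m → PQ ≤ R + 2 →
                n + 4 ≤ d + d′ → 1 ≤ R
        slack {d} {d′} {P} {Q} {PQ} {R} h₁ h₂ h₃ h₄ h₅ = +-cancelˡ-≤ (n + 3 + m) 1 R (begin
          (n + 3 + m) + 1        ≡⟨ e₁ n m ⟩
          (n + 4) + m            ≤⟨ +-monoˡ-≤ m h₅ ⟩
          (d + d′) + m           ≡⟨ +-assoc d d′ m ⟩
          d + (d′ + m)           ≤⟨ +-mono-≤ h₁ h₂ ⟩
          (P + 1) + (Q + n)      ≡⟨ e₂ P Q n ⟩
          (P + Q) + (n + 1)      ≤⟨ +-monoˡ-≤ (n + 1) (≤-trans h₃ (+-monoˡ-≤ m h₄)) ⟩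
          (R + 2 + m) + (n + 1)  ≡⟨ e₃ R m n ⟩
          (n + 3 + m) + R        ∎)
          where
          open ≤-Reasoning
          e₁ : ∀ n m → (n + 3 + m) + 1 ≡ (n + 4) + m
          e₁ = solve-∀
          e₂ : ∀ P Q n → (P + 1) + (Q + n) ≡ (P + Q) + (n + 1)
          e₂ = solve-∀
          e₃ : ∀ R m n → (R + 2 + m) + (n + 1) ≡ (n + 3 + m) + R
          e₃ = solve-∀

      switched : Σ (Fin n → Fin n) (PartialMatching (suc m))
      switched with j , sw ← switchable-row =
        Switching.switched x j free (from-does (toℕ j <? m) j-old) A-new A-j new-swap-free j-swap-free
        where
        not-j-swap : j-would-swap j ≡ false
        not-j-swap = not-true (proj₂ (∧-elim {both j ∧ not (new-would-swap j)} sw))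
        both-j : both j ≡ true
        both-j = proj₁ (∧-elim {both j} (proj₁ (∧-elim {both j ∧ not (new-would-swap j)} sw)))
        not-new-swap : new-would-swap j ≡ false
        not-new-swap = not-true (proj₂ (∧-elim {both j} (proj₁ (∧-elim {both j ∧ not (new-would-swap j)} sw))))
        feeds : feeds-new j ≡ true
        feeds = proj₁ (∧-elim {feeds-new j} both-j)
        j-old : old j ≡ true
        j-old = proj₁ (∧-elim {old j} feeds)
        A-new : A new (g j) ≡ true
        A-new = proj₂ (∧-elim {old j} feeds)
        A-j : A j x ≡ true
        A-j = proj₂ (∧-elim {old j} (proj₂ (∧-elim {feeds-new j} both-j)))
        new-swap-free : ∀ {l} → toℕ l < m → g l ≡ c new → g j ≡ c l → ⊥
        new-swap-free {l} l<m e₁ e₂ with () ← trans (sym not-new-swap)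
          (∧-intro j-old (dec-true (new-would-swap? j) (l , l<m , e₁ , e₂)))
        j-swap-free : ∀ {l} → x ≡ c l → g l ≡ c j → ⊥
        j-swap-free {l} e₁ e₂ with () ← trans (sym not-j-swap) (dec-true (j-would-swap? j) (l , e₁ , e₂))

    extend : Σ (Fin n → Fin n) (PartialMatching (suc m))
    extend with any? (λ y → direct y Bool.≟ true)
    ... | yes (y , d) =
      let (Ay , rest) = ∧-elim {A new y} d
          (free , no-swap-y) = ∧-elim {not (taken y)} rest
      in match-directly y Ay (not-true free) (not-true no-swap-y)
    ... | no none = let (x , free) = untaken-column in NoDirectChoice.switched (λ y → ¬-not (λ d → none (y , d))) x free

  matching-upto : (∀ i x → n + 4 ≤ count (A i) + count (λ j → A j x)) →
                  ∀ m → m ≤ n → Σ (Fin n → Fin n) (PartialMatching m)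
  matching-upto degrees zero _ = (λ z → z) , record { adjacent = λ _ () ; injective = λ _ _ () ; no-swap = λ _ _ () }
  matching-upto degrees (suc m) m<n with g , pm ← matching-upto degrees m (≤-trans (n≤1+n m) m<n) =
    Extend.extend degrees m m<n g pm

  swap-free-perfect-matching :
    (∀ i x → n + 4 ≤ count (A i) + count (λ j → A j x)) →
    Σ (Fin n → Fin n) λ f → (∀ {a b} → f a ≡ f b → a ≡ b) × (∀ i → A i (f i) ≡ true)
                          × (∀ a b → f a ≡ c b → f b ≡ c a → ⊥)
  swap-free-perfect-matching degrees with g , pm ← matching-upto degrees n ≤-refl =
    g , (λ {a} {b} → injective a b (toℕ<n a) (toℕ<n b)) , (λ i → adjacent i (toℕ<n i))
      , (λ a b → no-swap a b (toℕ<n a) (toℕ<n b))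
    where open PartialMatching pm

-- Leaves of induced subforests

least-witness : (P : ℕ → Set) → (∀ t → Dec (P t)) → ∀ N → P N → ∃[ t ] P t × (∀ s → s < t → ¬ P s)
least-witness P P? = <-rec (λ N → P N → ∃[ t ] P t × (∀ s → s < t → ¬ P s)) search
  where
  search : ∀ N → (∀ {s} → s < N → P s → ∃[ t ] P t × (∀ s → s < t → ¬ P s)) →
           P N → ∃[ t ] P t × (∀ s → s < t → ¬ P s)
  search N below pN with any? (λ (s : Fin N) → P? (toℕ s))
  ... | yes (s , ps) = below (toℕ<n s) ps
  ... | no none = N , pN , λ s s<N ps → none (fromℕ< s<N , subst P (sym (toℕ-fromℕ< s<N)) ps)

module _ {k : ℕ} (T : Graph k) (forest : IsForest T) (S : Fin k → Bool) where

  BranchesIn : Fin k → Set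
  BranchesIn v = ∃[ u ] ∃[ u′ ] (S u ≡ true × S u′ ≡ true) × ((Edge T v u × Edge T v u′) × u ≢ u′)

  branches-in? : ∀ v → Dec (BranchesIn v)
  branches-in? v = any? λ u → any? λ u′ → ((S u Bool.≟ true) ×-dec (S u′ Bool.≟ true)) ×-dec
                   (((adj T v u Bool.≟ true) ×-dec (adj T v u′ Bool.≟ true)) ×-dec ¬? (u ≟ u′))

  module NonBacktrackingWalk (branching : ∀ v → S v ≡ true → BranchesIn v) (v₀ : Fin k) (Sv₀ : S v₀ ≡ true) where

    onward : (p v : Fin k) → S v ≡ true → ∃[ x ] S x ≡ true × Edge T v x × x ≢ p
    onward p v Sv with branching v Sv
    ... | u , u′ , (Su , Su′) , (vu , vu′) , u≢u′ with u ≟ p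
    ... | yes refl = u′ , Su′ , vu′ , λ u′≡u → u≢u′ (sym u′≡u)
    ... | no u≢p = u , Su , vu , u≢p

    record Step : Set where
      field
        here next : Fin k
        S-next : S next ≡ true
        edge : Edge T here next

    turn : (s : Step) → ∃[ x ] S x ≡ true × Edge T (Step.next s) x × x ≢ Step.here s
    turn s = onward (Step.here s) (Step.next s) (Step.S-next s)

    steps : ℕ → Step
    steps zero = let (u , _ , (Su , _) , (vu , _) , _) = branching v₀ Sv₀ in
                 record { here = v₀ ; next = u ; S-next = Su ; edge = vu }
    steps (suc t) = let (x , Sx , vx , _) = turn (steps t) in
                    record { here = Step.next (steps t) ; next = x ; S-next = Sx ; edge = vx }

    w : ℕ → Fin k
    w t = Step.here (steps t)

    w-edge : ∀ t → Edge T (w t) (w (suc t))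
    w-edge t = Step.edge (steps t)

    w-no-backtrack : ∀ t → w (suc (suc t)) ≢ w t
    w-no-backtrack t = proj₂ (proj₂ (proj₂ (turn (steps t))))

    Revisits : ℕ → Set
    Revisits t = Σ (Fin t) λ s → w (toℕ s) ≡ w t

    revisits? : ∀ t → Dec (Revisits t)
    revisits? t = any? λ s → w (toℕ s) ≟ w t

    some-revisit : ∃[ t ] Revisits t
    some-revisit with i , j , i<j , wi≡wj ← pigeonhole (n<1+n k) (λ i → w (toℕ i)) =
      toℕ j , fromℕ< i<j , trans (cong w (toℕ-fromℕ< i<j)) wi≡wj

    segment : ℕ → ℕ → List (Fin k)
    segment a zero = []
    segment a (suc L) = w a ∷ segment (suc a) L

    segment-length : ∀ a L → length (segment a L) ≡ L
    segment-length a zero = refl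
    segment-length a (suc L) = cong suc (segment-length (suc a) L)

    segment-all : ∀ {Q : Fin k → Set} a L → (∀ i → a ≤ i → i < a + L → Q (w i)) → All Q (segment a L)
    segment-all a zero h = []
    segment-all a (suc L) h = h a ≤-refl (subst (a <_) (sym (+-suc a L)) (s≤s (m≤m+n a L)))
      ∷ segment-all (suc a) L (λ i a<i i< → h i (<⇒≤ a<i) (subst (i <_) (sym (+-suc a L)) i<))

    segment-distinct : ∀ a L → (∀ i j → a ≤ i → i < j → j < a + L → w i ≢ w j) →
                       AllPairs (λ x y → ¬ x ≡ y) (segment a L)
    segment-distinct a zero h = []
    segment-distinct a (suc L) h =
      segment-all (suc a) L (λ i a<i i< → h a i ≤-refl a<i (subst (i <_) (sym (+-suc a L)) i<))
      ∷ segment-distinct (suc a) L (λ i j a<i i<j j< → h i j (<⇒≤ a<i) i<j (subst (j <_) (sym (+-suc a L)) j<))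

    segment-path : ∀ a L → Path T (segment a L)
    segment-path a zero = _
    segment-path a (suc zero) = _
    segment-path a (suc (suc L)) = w-edge a , segment-path (suc a) (suc L)

    segment-last : ∀ a L → last (w a) (segment (suc a) L) ≡ w (a + L)
    segment-last a zero = cong w (sym (+-identityʳ a))
    segment-last a (suc L) = trans (segment-last (suc a) L) (cong w (sym (+-suc a L)))

    closed-walk-impossible : ∀ s L → (∀ i j → s ≤ i → i < j → j < s + L → w i ≢ w j) → 0 < L →
                             w s ≡ w (s + L) → ⊥
    closed-walk-impossible s 1 _ _ loop =
      Edge-irrefl T (subst (Edge T (w s)) (sym (trans loop (cong w (+-comm s 1)))) (w-edge s))
    closed-walk-impossible s 2 _ _ back = w-no-backtrack s (trans (cong w (+-comm 2 s)) (sym back))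
    closed-walk-impossible s (suc (suc (suc L))) distinct _ closed = forest (segment s (3 + L)) cycle
      where
      cycle : IsCycle T (segment s (3 + L))
      cycle = subst (3 ≤_) (sym (segment-length s (3 + L))) (s≤s (s≤s (s≤s z≤n))) ,
              segment-distinct s (3 + L) distinct ,
              segment-path s (3 + L) ,
              subst (λ z → Edge T z (w s)) (sym (segment-last s (2 + L)))
                (subst (Edge T (w (s + (2 + L)))) (trans (cong w (sym (+-suc s (2 + L)))) (sym closed))
                   (w-edge (s + (2 + L))))

    impossible : ⊥
    impossible with t , (s , ws≡wt) , first ← least-witness Revisits revisits? _ (proj₂ some-revisit) =
      closed-walk-impossible (toℕ s) (t ∸ toℕ s) distinct (m<n⇒0<n∸m (toℕ<n s))
        (trans ws≡wt (cong w (sym (m+[n∸m]≡n (<⇒≤ (toℕ<n s))))))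
      where
      distinct : ∀ i j → toℕ s ≤ i → i < j → j < toℕ s + (t ∸ toℕ s) → w i ≢ w j
      distinct i j _ i<j j< wi≡wj =
        first j (subst (j <_) (m+[n∸m]≡n (<⇒≤ (toℕ<n s))) j<) (fromℕ< i<j , trans (cong w (toℕ-fromℕ< i<j)) wi≡wj)

  induced-leaf : ∀ v₀ → S v₀ ≡ true →
    ∃[ v ] S v ≡ true × (∀ u u′ → S u ≡ true → S u′ ≡ true → Edge T v u → Edge T v u′ → u ≡ u′)
  induced-leaf v₀ Sv₀ with any? (λ v → (S v Bool.≟ true) ×-dec ¬? (branches-in? v))
  ... | yes (v , Sv , ¬branches) = v , Sv , λ u u′ Su Su′ vu vu′ → decidable-stable (u ≟ u′)
          (λ u≢u′ → ¬branches (u , u′ , (Su , Su′) , (vu , vu′) , u≢u′))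
  ... | no none = ⊥-elim (NonBacktrackingWalk.impossible branching v₀ Sv₀)
    where
    branching : ∀ v → S v ≡ true → BranchesIn v
    branching v Sv = decidable-stable (branches-in? v) (λ ¬b → none (v , Sv , ¬b))

-- Packings of copies of T

module _ {k n : ℕ} (T : Graph k) (F : Graph n) where

  UsedBy : (Fin k → Bool) → (Fin k → Fin n → Fin n) → Fin n → Fin n → Set
  UsedBy S σ a x = ∃[ j ] ∃[ u ] ∃[ u′ ] (S u ≡ true × S u′ ≡ true) × (Edge T u u′ × (σ u j ≡ a × σ u′ j ≡ x))

  used? : ∀ S σ a x → Dec (UsedBy S σ a x)
  used? S σ a x = any? λ j → any? λ u → any? λ u′ → ((S u Bool.≟ true) ×-dec (S u′ Bool.≟ true)) ×-dec
    ((adj T u u′ Bool.≟ true) ×-dec ((σ u j ≟ a) ×-dec (σ u′ j ≟ x)))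

  used : (Fin k → Bool) → (Fin k → Fin n → Fin n) → Fin n → Fin n → Bool
  used S σ a x = does (used? S σ a x)

  UsedBy-sym : ∀ {S σ a x} → UsedBy S σ a x → UsedBy S σ x a
  UsedBy-sym (j , u , u′ , (Su , Su′) , uu′ , σu , σu′) = j , u′ , u , (Su′ , Su) , Edge-sym T uu′ , σu′ , σu

  Hits : (Fin k → Bool) → (Fin k → Fin n → Fin n) → Fin n → Fin n → Set
  Hits S σ i x = ∃[ u ] S u ≡ true × σ u i ≡ x

  hits? : ∀ S σ i x → Dec (Hits S σ i x)
  hits? S σ i x = any? λ u → (S u Bool.≟ true) ×-dec (σ u i ≟ x)

  hits : (Fin k → Bool) → (Fin k → Fin n → Fin n) → Fin n → Fin n → Bool
  hits S σ i x = does (hits? S σ i x)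

  -- Copy i of T[S] sends u to σ u i.  used-bound holds because a vertex of F is the image of each u ∈ S
  -- in exactly one copy and the degrees of the forest T[S] sum to at most 2|S| - 2.
  record PartialPacking (S : Fin k → Bool) : Set where
    field
      σ : Fin k → Fin n → Fin n
      images-distinct : ∀ u → S u ≡ true → ∀ {i j} → σ u i ≡ σ u j → i ≡ j
      copy-edge : ∀ u u′ i → S u ≡ true → S u′ ≡ true → Edge T u u′ → Edge F (σ u i) (σ u′ i)
      copy-injective : ∀ u u′ i → S u ≡ true → S u′ ≡ true → σ u i ≡ σ u′ i → u ≡ u′
      edge-disjoint : ∀ i j u u′ w w′ → i ≢ j → S u ≡ true → S u′ ≡ true → S w ≡ true → S w′ ≡ true →
                      Edge T u u′ → Edge T w w′ → σ u i ≡ σ w j → σ u′ i ≡ σ w′ j → ⊥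
      used-bound : ∀ a → count (used S σ a) + 2 ≤ 2 * count S

  module _ {S : Fin k → Bool} (P : PartialPacking S) where
    open PartialPacking P

    count-used : ∀ t → count S ≡ suc t → ∀ a → count (used S σ a) ≤ 2 * t
    count-used t |S| a = +-cancelʳ-≤ 2 _ _ (subst (count (used S σ a) + 2 ≤_)
      (trans (cong (2 *_) |S|) (trans (*-suc 2 t) (+-comm 2 (2 * t)))) (used-bound a))

    count-row-hits : ∀ (R : Fin k → Bool) i (q : Fin n → Bool) →
      (∀ u → S u ≡ true → q (σ u i) ≡ true → R u ≡ true) → count (λ x → q x ∧ hits S σ i x) ≤ count R
    count-row-hits R i q into-R = count-injection _ R (λ x e → proj₁ (hitter x e))
      (λ x e → let (u , Su , σui≡x) = hitter x e in
               into-R u Su (subst (λ z → q z ≡ true) (sym σui≡x) (proj₁ (∧-elim e))))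
      (λ x x′ e e′ u≡u′ → trans (sym (proj₂ (proj₂ (hitter x e))))
                            (trans (cong (λ z → σ z i) u≡u′) (proj₂ (proj₂ (hitter x′ e′)))))
      where
      hitter : ∀ x → (q x ∧ hits S σ i x) ≡ true → Hits S σ i x
      hitter x e = from-does (hits? S σ i x) (proj₂ (∧-elim {q x} e))

    count-column-hits : ∀ (R : Fin k → Bool) x (q : Fin n → Bool) →
      (∀ u j → S u ≡ true → σ u j ≡ x → q j ≡ true → R u ≡ true) → count (λ j → q j ∧ hits S σ j x) ≤ count R
    count-column-hits R x q into-R = count-injection _ R (λ j e → proj₁ (hitter j e))
      (λ j e → let (u , Su , σuj≡x) = hitter j e in into-R u j Su σuj≡x (proj₁ (∧-elim e)))
      (λ j j′ e e′ u≡u′ → let (u , Su , σuj≡x) = hitter j e ; (u′ , _ , σu′j′≡x) = hitter j′ e′ in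
        images-distinct u Su (trans σuj≡x (trans (sym σu′j′≡x) (cong (λ z → σ z j′) (sym u≡u′)))))
      where
      hitter : ∀ j → (q j ∧ hits S σ j x) ≡ true → Hits S σ j x
      hitter j e = from-does (hits? S σ j x) (proj₂ (∧-elim {q j} e))

  module AddLeaf (S′ : Fin k → Bool) (v : Fin k) (S′v : S′ v ≡ true)
                 (leaf : ∀ u u′ → S′ u ≡ true → S′ u′ ≡ true → Edge T v u → Edge T v u′ → u ≡ u′)
                 (P : PartialPacking (S′ ∖ v)) where
    open PartialPacking P

    S : Fin k → Bool
    S = S′ ∖ v

    parent-unique : ∀ {u u′} → S u ≡ true → S u′ ≡ true → Edge T v u → Edge T v u′ → u ≡ u′
    parent-unique {u} {u′} Su Su′ = leaf u u′ (∖-⊆ {S = S′} Su) (∖-⊆ {S = S′} Su′)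

    record Attachment (f : Fin n → Fin n) : Set where
      field
        f-injective : ∀ {i j} → f i ≡ f j → i ≡ j
        fresh : ∀ i u → S u ≡ true → σ u i ≢ f i
        f-edge : ∀ u i → S u ≡ true → Edge T v u → Edge F (f i) (σ u i)
        unused : ∀ i j u w w′ → S u ≡ true → S w ≡ true → S w′ ≡ true → Edge T v u → Edge T w w′ →
                 f i ≡ σ w j → σ u i ≡ σ w′ j → ⊥
        no-swap : ∀ i j u u′ → i ≢ j → S u ≡ true → S u′ ≡ true → Edge T v u → Edge T v u′ →
                  f i ≡ σ u′ j → σ u i ≡ f j → ⊥

    data Member (u : Fin k) : Set where
      is-v : u ≡ v → Member u
      is-old : S u ≡ true → Member u

    member : ∀ u → S′ u ≡ true → Member u
    member u S′u with u ≟ v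
    ... | yes u≡v = is-v u≡v
    ... | no u≢v = is-old (∈-∖ {S = S′} S′u u≢v)

    module _ {f : Fin n → Fin n} (att : Attachment f) where
      open Attachment att

      σ′ : Fin k → Fin n → Fin n
      σ′ = updateAt σ v (const f)

      σ′-v : ∀ i → σ′ v i ≡ f i
      σ′-v i = cong (λ g → g i) (updateAt-updates v σ)

      σ′-old : ∀ {u} → S u ≡ true → ∀ i → σ′ u i ≡ σ u i
      σ′-old {u} Su i = cong (λ g → g i) (updateAt-minimal u v σ (∖-≢ {S = S′} Su))

      images-distinct′ : ∀ u → S′ u ≡ true → ∀ {i j} → σ′ u i ≡ σ′ u j → i ≡ j
      images-distinct′ u S′u {i} {j} e with member u S′u
      ... | is-v refl rewrite σ′-v i | σ′-v j = f-injective e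
      ... | is-old Su rewrite σ′-old Su i | σ′-old Su j = images-distinct u Su e

      copy-edge′ : ∀ u u′ i → S′ u ≡ true → S′ u′ ≡ true → Edge T u u′ → Edge F (σ′ u i) (σ′ u′ i)
      copy-edge′ u u′ i S′u S′u′ uu′ with member u S′u | member u′ S′u′
      ... | is-v refl | is-v refl = ⊥-elim (Edge-irrefl T uu′)
      ... | is-v refl | is-old Su′ rewrite σ′-v i | σ′-old Su′ i = f-edge u′ i Su′ uu′
      ... | is-old Su | is-v refl rewrite σ′-v i | σ′-old Su i = Edge-sym F (f-edge u i Su (Edge-sym T uu′))
      ... | is-old Su | is-old Su′ rewrite σ′-old Su i | σ′-old Su′ i = copy-edge u u′ i Su Su′ uu′

      copy-injective′ : ∀ u u′ i → S′ u ≡ true → S′ u′ ≡ true → σ′ u i ≡ σ′ u′ i → u ≡ u′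
      copy-injective′ u u′ i S′u S′u′ e with member u S′u | member u′ S′u′
      ... | is-v refl | is-v refl = refl
      ... | is-v refl | is-old Su′ rewrite σ′-v i | σ′-old Su′ i = ⊥-elim (fresh i u′ Su′ (sym e))
      ... | is-old Su | is-v refl rewrite σ′-v i | σ′-old Su i = ⊥-elim (fresh i u Su e)
      ... | is-old Su | is-old Su′ rewrite σ′-old Su i | σ′-old Su′ i = copy-injective u u′ i Su Su′ e

      edge-disjoint′ : ∀ i j u u′ w w′ → i ≢ j → S′ u ≡ true → S′ u′ ≡ true → S′ w ≡ true → S′ w′ ≡ true →
                       Edge T u u′ → Edge T w w′ → σ′ u i ≡ σ′ w j → σ′ u′ i ≡ σ′ w′ j → ⊥
      edge-disjoint′ i j u u′ w w′ i≢j S′u S′u′ S′w S′w′ uu′ ww′ q₁ q₂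
        with member u S′u | member u′ S′u′ | member w S′w | member w′ S′w′
      ... | is-v refl | is-v refl | _ | _ = Edge-irrefl T uu′
      ... | _ | _ | is-v refl | is-v refl = Edge-irrefl T ww′
      ... | is-v refl | is-old Su′ | is-v refl | is-old Sw′
            rewrite σ′-v i | σ′-v j = i≢j (f-injective q₁)
      ... | is-v refl | is-old Su′ | is-old Sw | is-v refl
            rewrite σ′-v i | σ′-v j | σ′-old Su′ i | σ′-old Sw j = no-swap i j u′ w i≢j Su′ Sw uu′ (Edge-sym T ww′) q₁ q₂
      ... | is-v refl | is-old Su′ | is-old Sw | is-old Sw′
            rewrite σ′-v i | σ′-old Su′ i | σ′-old Sw j | σ′-old Sw′ j = unused i j u′ w w′ Su′ Sw Sw′ uu′ ww′ q₁ q₂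
      ... | is-old Su | is-v refl | is-v refl | is-old Sw′
            rewrite σ′-v i | σ′-v j | σ′-old Su i | σ′-old Sw′ j =
              no-swap j i w′ u (λ j≡i → i≢j (sym j≡i)) Sw′ Su ww′ (Edge-sym T uu′) (sym q₁) (sym q₂)
      ... | is-old Su | is-v refl | is-old Sw | is-v refl
            rewrite σ′-v i | σ′-v j = i≢j (f-injective q₂)
      ... | is-old Su | is-v refl | is-old Sw | is-old Sw′
            rewrite σ′-v i | σ′-old Su i | σ′-old Sw j | σ′-old Sw′ j =
              unused i j u w′ w Su Sw′ Sw (Edge-sym T uu′) (Edge-sym T ww′) q₂ q₁
      ... | is-old Su | is-old Su′ | is-v refl | is-old Sw′
            rewrite σ′-v j | σ′-old Su i | σ′-old Su′ i | σ′-old Sw′ j =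
              unused j i w′ u u′ Sw′ Su Su′ ww′ uu′ (sym q₁) (sym q₂)
      ... | is-old Su | is-old Su′ | is-old Sw | is-v refl
            rewrite σ′-v j | σ′-old Su i | σ′-old Su′ i | σ′-old Sw j =
              unused j i w u′ u Sw Su′ Su (Edge-sym T ww′) (Edge-sym T uu′) (sym q₂) (sym q₁)
      ... | is-old Su | is-old Su′ | is-old Sw | is-old Sw′
            rewrite σ′-old Su i | σ′-old Su′ i | σ′-old Sw j | σ′-old Sw′ j =
              edge-disjoint i j u u′ w w′ i≢j Su Su′ Sw Sw′ uu′ ww′ q₁ q₂

      FromLeaf : Fin n → Fin n → Set
      FromLeaf a x = ∃[ i ] ∃[ u ] (S u ≡ true × Edge T v u) × (f i ≡ a × σ u i ≡ x)

      from-leaf? : ∀ a x → Dec (FromLeaf a x)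
      from-leaf? a x = any? λ i → any? λ u →
        ((S u Bool.≟ true) ×-dec (adj T v u Bool.≟ true)) ×-dec ((f i ≟ a) ×-dec (σ u i ≟ x))

      from-leaf : Fin n → Fin n → Bool
      from-leaf a x = does (from-leaf? a x)

      ToLeaf : Fin n → Fin n → Set
      ToLeaf a x = ∃[ i ] ∃[ u ] (S u ≡ true × Edge T v u) × (σ u i ≡ a × f i ≡ x)

      to-leaf? : ∀ a x → Dec (ToLeaf a x)
      to-leaf? a x = any? λ i → any? λ u →
        ((S u Bool.≟ true) ×-dec (adj T v u Bool.≟ true)) ×-dec ((σ u i ≟ a) ×-dec (f i ≟ x))

      to-leaf : Fin n → Fin n → Bool
      to-leaf a x = does (to-leaf? a x)

      used-new : ∀ a x → UsedBy S′ σ′ a x → UsedBy S σ a x ⊎ (FromLeaf a x ⊎ ToLeaf a x)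
      used-new a x (j , u , u′ , (S′u , S′u′) , uu′ , q₁ , q₂) with member u S′u | member u′ S′u′
      ... | is-v refl | is-v refl = ⊥-elim (Edge-irrefl T uu′)
      ... | is-v refl | is-old Su′ rewrite σ′-v j | σ′-old Su′ j =
            inj₂ (inj₁ (j , u′ , (Su′ , uu′) , q₁ , q₂))
      ... | is-old Su | is-v refl rewrite σ′-v j | σ′-old Su j =
            inj₂ (inj₂ (j , u , (Su , Edge-sym T uu′) , q₁ , q₂))
      ... | is-old Su | is-old Su′ rewrite σ′-old Su j | σ′-old Su′ j =
            inj₁ (j , u , u′ , (Su , Su′) , uu′ , q₁ , q₂)

      count-used-new : ∀ a → count (used S′ σ′ a) ≤ count (used S σ a) + (count (from-leaf a) + count (to-leaf a))
      count-used-new a = ≤-trans (count-mono classified)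
        (≤-trans (count-∨ (used S σ a) _) (+-monoʳ-≤ _ (count-∨ (from-leaf a) (to-leaf a))))
        where
        classified : ∀ x → used S′ σ′ a x ≡ true → (used S σ a x ∨ (from-leaf a x ∨ to-leaf a x)) ≡ true
        classified x e with used-new a x (from-does (used? S′ σ′ a x) e)
        ... | inj₁ old rewrite dec-true (used? S σ a x) old = refl
        ... | inj₂ (inj₁ from) rewrite dec-true (from-leaf? a x) from = ∨-zeroʳ (used S σ a x)
        ... | inj₂ (inj₂ to) rewrite dec-true (to-leaf? a x) to =
              trans (cong (used S σ a x ∨_) (∨-zeroʳ (from-leaf a x))) (∨-zeroʳ (used S σ a x))

      count-from-leaf : ∀ a → count (from-leaf a) ≤ 1
      count-from-leaf a = count-≤1 _ λ x x′ p p′ →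
        let (i , u , (Su , vu) , fi≡a , σui≡x) = from-does (from-leaf? a x) p
            (i′ , u′ , (Su′ , vu′) , fi′≡a , σu′i′≡x′) = from-does (from-leaf? a x′) p′
        in trans (sym σui≡x) (trans (cong₂ σ (parent-unique Su Su′ vu vu′)
                                             (f-injective (trans fi≡a (sym fi′≡a)))) σu′i′≡x′)

      count-to-leaf : ∀ a → count (to-leaf a) ≤ 1
      count-to-leaf a = count-≤1 _ λ x x′ p p′ →
        let (i , u , (Su , vu) , σui≡a , fi≡x) = from-does (to-leaf? a x) p
            (i′ , u′ , (Su′ , vu′) , σu′i′≡a , fi′≡x′) = from-does (to-leaf? a x′) p′
            σui≡σui′ = trans σui≡a (trans (sym σu′i′≡a) (cong (λ z → σ z i′) (sym (parent-unique Su Su′ vu vu′))))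
        in trans (sym fi≡x) (trans (cong f (images-distinct u Su σui≡σui′)) fi′≡x′)

      used-bound′ : ∀ a → count (used S′ σ′ a) + 2 ≤ 2 * count S′
      used-bound′ a = begin
        count (used S′ σ′ a) + 2                                               ≤⟨ +-monoˡ-≤ 2 (count-used-new a) ⟩
        count (used S σ a) + (count (from-leaf a) + count (to-leaf a)) + 2
          ≤⟨ +-monoˡ-≤ 2 (+-monoʳ-≤ (count (used S σ a)) (+-mono-≤ (count-from-leaf a) (count-to-leaf a))) ⟩
        count (used S σ a) + 2 + 2                 ≤⟨ +-monoˡ-≤ 2 (used-bound a) ⟩
        2 * count S + 2                            ≡⟨ +-comm (2 * count S) 2 ⟩
        2 + 2 * count S                            ≡⟨ sym (*-suc 2 (count S)) ⟩
        2 * suc (count S)                          ≡⟨ cong (2 *_) (sym (count-remove S′ v S′v)) ⟩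
        2 * count S′                               ∎
        where open ≤-Reasoning

      attach : PartialPacking S′
      attach = record { σ = σ′ ; images-distinct = images-distinct′ ; copy-edge = copy-edge′
                      ; copy-injective = copy-injective′ ; edge-disjoint = edge-disjoint′ ; used-bound = used-bound′ }

  module ExtendByLeaf (mindeg : MinDegAtLeastTwoThirds F) (big : 6 * (k * k) < n)
                      (S′ : Fin k → Bool) (v : Fin k) (S′v : S′ v ≡ true)
                      (leaf : ∀ u u′ → S′ u ≡ true → S′ u′ ≡ true → Edge T v u → Edge T v u′ → u ≡ u′)
                      (P : PartialPacking (S′ ∖ v)) (t : ℕ) (|S| : count (S′ ∖ v) ≡ suc t) where
    open AddLeaf S′ v S′v leaf P
    open PartialPacking P

    18t+12≤n : 18 * t + 12 ≤ n
    18t+12≤n = 6k²-bound k t n t+2≤k big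
      where
      t+2≤k : t + 2 ≤ k
      t+2≤k = subst (_≤ k) (trans (count-remove S′ v S′v) (trans (cong suc |S|) (+-comm 2 t))) (count-≤ S′)

    module ToParent (p : Fin k) (Sp : S p ≡ true) (vp : Edge T v p) where
      A : Fin n → Fin n → Bool
      A i x = (adj F (σ p i) x ∧ not (hits S σ i x)) ∧ not (used S σ (σ p i) x)

      A-σp : ∀ i → A i (σ p i) ≡ false
      A-σp i rewrite irrefl F (σ p i) = refl

      |S∖p| : count (S ∖ p) ≡ t
      |S∖p| = suc-injective (trans (sym (count-remove S p Sp)) |S|)

      row : ∀ i → degree F (σ p i) ≤ count (A i) + 3 * t
      row i = begin
        count (adj F a)                                           ≤⟨ count-partition (adj F a) (hits S σ i) ⟩
        count (λ x → adj F a x ∧ not (hits S σ i x)) + count hit  ≤⟨ +-mono-≤ (count-split _ (used S σ a)) hit≤t ⟩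
        count (A i) + count (used S σ a) + t                      ≤⟨ +-monoˡ-≤ t (+-monoʳ-≤ (count (A i)) (count-used P t |S| a)) ⟩
        count (A i) + 2 * t + t                                   ≡⟨ +-assoc (count (A i)) (2 * t) t ⟩
        count (A i) + (2 * t + t)                                 ≡⟨ cong (count (A i) +_) (+-comm (2 * t) t) ⟩
        count (A i) + 3 * t                                       ∎
        where
        open ≤-Reasoning
        a : Fin n
        a = σ p i
        hit : Fin n → Bool
        hit x = adj F a x ∧ hits S σ i x
        u≢p : ∀ u → S u ≡ true → adj F a (σ u i) ≡ true → u ≢ p
        u≢p u Su au refl = Edge-irrefl F au
        hit≤t : count hit ≤ t
        hit≤t = subst (count hit ≤_) |S∖p|
                  (count-row-hits P (S ∖ p) i (adj F a) (λ u Su au → ∈-∖ {S = S} Su (u≢p u Su au)))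

      column : ∀ x → degree F x ≤ count (λ j → A j x) + 3 * t
      column x = begin
        count (adj F x)                             ≤⟨ count≤count-∘ (σ p) (images-distinct p Sp) (adj F x) ⟩
        count (λ i → adj F x (σ p i))               ≡⟨ count-cong (λ i → Graph.sym F x (σ p i)) ⟩
        count B                                     ≤⟨ count-partition B (λ i → hits S σ i x) ⟩
        count (λ i → B i ∧ not (hits S σ i x)) + count hit
                                                    ≤⟨ +-mono-≤ (count-split _ (λ i → used S σ (σ p i) x)) hit≤t ⟩
        count (λ j → A j x) + count (λ i → used S σ (σ p i) x) + t
                                                    ≤⟨ +-monoˡ-≤ t (+-monoʳ-≤ (count (λ j → A j x)) used≤2t) ⟩
        count (λ j → A j x) + 2 * t + t             ≡⟨ +-assoc (count (λ j → A j x)) (2 * t) t ⟩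
        count (λ j → A j x) + (2 * t + t)           ≡⟨ cong (count (λ j → A j x) +_) (+-comm (2 * t) t) ⟩
        count (λ j → A j x) + 3 * t                 ∎
        where
        open ≤-Reasoning
        B : Fin n → Bool
        B i = adj F (σ p i) x
        hit : Fin n → Bool
        hit i = B i ∧ hits S σ i x
        u≢p : ∀ u j → σ u j ≡ x → B j ≡ true → u ≢ p
        u≢p u j σuj≡x Bj refl = Edge-irrefl F (subst (Edge F (σ p j)) (sym σuj≡x) Bj)
        hit≤t : count hit ≤ t
        hit≤t = subst (count hit ≤_) |S∖p|
                  (count-column-hits P (S ∖ p) x B (λ u j Su σuj≡x Bj → ∈-∖ {S = S} Su (u≢p u j σuj≡x Bj)))
        used≤2t : count (λ i → used S σ (σ p i) x) ≤ 2 * t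
        used≤2t = ≤-trans (count-injection _ (used S σ x) (λ i _ → σ p i)
          (λ i e → dec-true (used? S σ x (σ p i)) (UsedBy-sym (from-does (used? S σ (σ p i) x) e)))
          (λ i i′ _ _ → images-distinct p Sp)) (count-used P t |S| x)

      degrees : ∀ i x → n + 4 ≤ count (A i) + count (λ j → A j x)
      degrees i x = degree-sum-from-thirds n t (count (A i)) (count (λ j → A j x))
                      (mindeg (σ p i)) (mindeg x) (row i) (column x) 18t+12≤n

      attach-matching : (f : Fin n → Fin n) → (∀ {i j} → f i ≡ f j → i ≡ j) → (∀ i → A i (f i) ≡ true) →
                        (∀ a b → f a ≡ σ p b → f b ≡ σ p a → ⊥) → PartialPacking S′
      attach-matching f f-inj f-A f-no-swap =
        attach record { f-injective = f-inj ; fresh = fresh ; f-edge = f-edge ; unused = unused ; no-swap = no-swap }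
        where
        parts : ∀ i → (Edge F (σ p i) (f i) × hits S σ i (f i) ≡ false) × used S σ (σ p i) (f i) ≡ false
        parts i = let (left , right) = ∧-elim {adj F (σ p i) (f i) ∧ not (hits S σ i (f i))} (f-A i)
                      (adjacent , unhit) = ∧-elim {adj F (σ p i) (f i)} left
                  in (adjacent , not-true unhit) , not-true right
        fresh : ∀ i u → S u ≡ true → σ u i ≢ f i
        fresh i u Su e with () ← trans (sym (proj₂ (proj₁ (parts i)))) (dec-true (hits? S σ i (f i)) (u , Su , e))
        f-edge : ∀ u i → S u ≡ true → Edge T v u → Edge F (f i) (σ u i)
        f-edge u i Su vu with refl ← parent-unique Su Sp vu vp = Edge-sym F (proj₁ (proj₁ (parts i)))
        unused : ∀ i j u w w′ → S u ≡ true → S w ≡ true → S w′ ≡ true → Edge T v u → Edge T w w′ →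
                 f i ≡ σ w j → σ u i ≡ σ w′ j → ⊥
        unused i j u w w′ Su Sw Sw′ vu ww′ q₁ q₂ with refl ← parent-unique Su Sp vu vp
          with () ← trans (sym (proj₂ (parts i)))
                      (dec-true (used? S σ (σ u i) (f i)) (j , w′ , w , (Sw′ , Sw) , Edge-sym T ww′ , sym q₂ , sym q₁))
        no-swap : ∀ i j u u′ → i ≢ j → S u ≡ true → S u′ ≡ true → Edge T v u → Edge T v u′ →
                  f i ≡ σ u′ j → σ u i ≡ f j → ⊥
        no-swap i j u u′ _ Su Su′ vu vu′ q₁ q₂
          with refl ← parent-unique Su Sp vu vp
             | refl ← parent-unique Su′ Sp vu′ vp = f-no-swap i j q₁ (sym q₂)

      attached : PartialPacking S′
      attached = let (f , f-inj , f-A , f-no-swap) = swap-free-perfect-matching A (σ p) (images-distinct p Sp) A-σp degrees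
                 in attach-matching f f-inj f-A f-no-swap

    -- Without a parent no new edge appears, so swaps are harmless and σ w₀ only has to be some
    -- permutation avoiding the admissible pairs.
    module Isolated (w₀ : Fin k) (Sw₀ : S w₀ ≡ true) (no-parent : ∀ p → S p ≡ true → ¬ Edge T v p) where
      A : Fin n → Fin n → Bool
      A i x = not (hits S σ i x)

      A-σw₀ : ∀ i → A i (σ w₀ i) ≡ false
      A-σw₀ i rewrite dec-true (hits? S σ i (σ w₀ i)) (w₀ , Sw₀ , refl) = refl

      row : ∀ i → n ≤ count (A i) + suc t
      row i = begin
        n                                    ≡⟨ sym (count-not (hits S σ i)) ⟩
        count (hits S σ i) + count (A i)     ≤⟨ +-monoˡ-≤ (count (A i)) hits≤ ⟩
        suc t + count (A i)                  ≡⟨ +-comm (suc t) _ ⟩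
        count (A i) + suc t                  ∎
        where
        open ≤-Reasoning
        hits≤ : count (hits S σ i) ≤ suc t
        hits≤ = subst (count (hits S σ i) ≤_) |S| (count-row-hits P S i (λ _ → true) (λ u Su _ → Su))

      column : ∀ x → n ≤ count (λ j → A j x) + suc t
      column x = begin
        n                                                      ≡⟨ sym (count-not (λ j → hits S σ j x)) ⟩
        count (λ j → hits S σ j x) + count (λ j → A j x)       ≤⟨ +-monoˡ-≤ (count (λ j → A j x)) hits≤ ⟩
        suc t + count (λ j → A j x)                            ≡⟨ +-comm (suc t) _ ⟩
        count (λ j → A j x) + suc t                            ∎
        where
        open ≤-Reasoning
        hits≤ : count (λ j → hits S σ j x) ≤ suc t
        hits≤ = subst (count (λ j → hits S σ j x) ≤_) |S| (count-column-hits P S x (λ _ → true) (λ u j Su _ _ → Su))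

      degrees : ∀ i x → n + 4 ≤ count (A i) + count (λ j → A j x)
      degrees i x = degree-sum-from-complements n t (row i) (column x) 18t+12≤n

      attach-matching : (f : Fin n → Fin n) → (∀ {i j} → f i ≡ f j → i ≡ j) → (∀ i → A i (f i) ≡ true) →
                        PartialPacking S′
      attach-matching f f-inj f-A =
        attach record { f-injective = f-inj ; fresh = fresh
                      ; f-edge = λ u i Su vu → ⊥-elim (no-parent u Su vu)
                      ; unused = λ i j u w w′ Su _ _ vu _ _ _ → no-parent u Su vu
                      ; no-swap = λ i j u u′ _ Su _ vu _ _ _ → no-parent u Su vu }
        where
        fresh : ∀ i u → S u ≡ true → σ u i ≢ f i
        fresh i u Su e with () ← trans (sym (not-true (f-A i))) (dec-true (hits? S σ i (f i)) (u , Su , e))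

      attached : PartialPacking S′
      attached = let (f , f-inj , f-A , _) = swap-free-perfect-matching A (σ w₀) (images-distinct w₀ Sw₀) A-σw₀ degrees
                 in attach-matching f f-inj f-A

    extended : PartialPacking S′
    extended with any? (λ p → (S p Bool.≟ true) ×-dec (adj T v p Bool.≟ true))
    ... | yes (p , Sp , vp) = ToParent.attached p Sp vp
    ... | no none with w₀ , Sw₀ ← count>0⇒∃ S (subst (0 <_) (sym |S|) (s≤s z≤n)) =
      Isolated.attached w₀ Sw₀ (λ p Sp vp → none (p , Sp , vp))

  singleton-packing : ∀ (S : Fin k → Bool) → count S ≡ 1 → PartialPacking S
  singleton-packing S |S|≡1 = record
    { σ = λ _ i → i
    ; images-distinct = λ _ _ e → e
    ; copy-edge = λ u u′ i Su Su′ uu′ → ⊥-elim (no-edge Su Su′ uu′)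
    ; copy-injective = λ u u′ _ Su Su′ _ → trans (only u Su) (sym (only u′ Su′))
    ; edge-disjoint = λ i j u u′ w w′ _ Su Su′ _ _ uu′ _ _ _ → no-edge Su Su′ uu′
    ; used-bound = λ a → subst (λ s → count (used S (λ _ i → i) a) + 2 ≤ 2 * s) (sym |S|≡1)
        (≤-reflexive (cong (_+ 2) (count-false (λ x → dec-false (used? S (λ _ i → i) a x)
          λ { (_ , u , u′ , (Su , Su′) , uu′ , _) → no-edge Su Su′ uu′ }))))
    }
    where
    v₀ : Fin k
    v₀ = proj₁ (count>0⇒∃ S (subst (0 <_) (sym |S|≡1) (s≤s z≤n)))
    Sv₀ : S v₀ ≡ true
    Sv₀ = proj₂ (count>0⇒∃ S (subst (0 <_) (sym |S|≡1) (s≤s z≤n)))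
    only : ∀ u → S u ≡ true → u ≡ v₀
    only u Su with u ≟ v₀
    ... | yes u≡v₀ = u≡v₀
    ... | no u≢v₀ = ⊥-elim (<-irrefl refl (begin-strict
          1               ≤⟨ ∃⇒count>0 (S ∖ v₀) u (∈-∖ {S = S} Su u≢v₀) ⟩
          count (S ∖ v₀)  <⟨ ≤-reflexive (sym (count-remove S v₀ Sv₀)) ⟩
          count S         ≡⟨ |S|≡1 ⟩
          1               ∎))
      where open ≤-Reasoning
    no-edge : ∀ {u u′} → S u ≡ true → S u′ ≡ true → ¬ Edge T u u′
    no-edge {u} {u′} Su Su′ uu′ rewrite only u Su | only u′ Su′ = Edge-irrefl T uu′

  grow : IsForest T → MinDegAtLeastTwoThirds F → 6 * (k * k) < n →
         ∀ m (S′ : Fin k → Bool) → count S′ ≡ suc m → PartialPacking S′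
  grow forest mindeg big zero S′ |S′| = singleton-packing S′ |S′|
  grow forest mindeg big (suc m) S′ |S′| =
    let (v₀ , S′v₀) = count>0⇒∃ S′ (subst (0 <_) (sym |S′|) (s≤s z≤n))
        (v , S′v , leaf) = induced-leaf T forest S′ v₀ S′v₀
        |S′∖v| = suc-injective (trans (sym (count-remove S′ v S′v)) |S′|)
    in ExtendByLeaf.extended mindeg big S′ v S′v leaf (grow forest mindeg big m (S′ ∖ v) |S′∖v|) m |S′∖v|

  module _ (P : PartialPacking (λ _ → true)) where
    open PartialPacking P

    copy : Fin n → Copy T F
    copy i = record { φ = λ u → σ u i ; inj = λ {u} {u′} → copy-injective u u′ i refl refl
                    ; edges = λ u u′ → copy-edge u u′ i refl refl }

    copies-edge-disjoint : ∀ i j → i ≢ j → EdgeDisjoint (copy i) (copy j)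
    copies-edge-disjoint i j i≢j x y (u , u′ , uu′ , σu≡x , σu′≡y) (w , w′ , ww′ , σw≡x , σw′≡y) =
      edge-disjoint i j u u′ w w′ i≢j refl refl refl refl uu′ ww′ (trans σu≡x (sym σw≡x)) (trans σu′≡y (sym σw′≡y))

    images-injective : ∀ u → Injective _≡_ _≡_ (λ i → φ (copy i) u)
    images-injective u = images-distinct u refl

    copies-through : ∀ x → count (λ i → inCopy (copy i) x) ≡ k
    copies-through x = ≤-antisym
      (subst (count (λ i → inCopy (copy i) x) ≤_) (count-true k)
        (count-injection _ (λ _ → true) (λ i e → proj₁ (preimage i e)) (λ _ _ → refl)
          (λ i i′ e e′ u≡u′ → images-distinct (proj₁ (preimage i e)) refl
            (trans (proj₂ (preimage i e)) (trans (sym (proj₂ (preimage i′ e′))) (cong (λ z → σ z i′) (sym u≡u′)))))))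
      (subst (_≤ count (λ i → inCopy (copy i) x)) (count-true k)
        (count-injection (λ _ → true) _ (λ u _ → proj₁ (copy-through u))
          (λ u _ → dec-true (any? (λ u′ → σ u′ (proj₁ (copy-through u)) ≟ x)) (u , proj₂ (copy-through u)))
          (λ u u′ _ _ i≡i′ → copy-injective u u′ (proj₁ (copy-through u)) refl refl
            (trans (proj₂ (copy-through u)) (trans (sym (proj₂ (copy-through u′))) (cong (σ u′) (sym i≡i′)))))))
      where
      preimage : ∀ i → inCopy (copy i) x ≡ true → ∃[ u ] σ u i ≡ x
      preimage i = from-does (any? (λ u → σ u i ≟ x))
      copy-through : ∀ u → ∃[ i ] σ u i ≡ x
      copy-through u = injective⇒surjective (σ u) (images-distinct u refl) x

lemma5 : (k : ℕ) → .{{_ : NonZero k}} → (n : ℕ) → 6 * (k * k) < n →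
         (T : Graph k) → IsForest T →
         (F : Graph n) → MinDegAtLeastTwoThirds F →
         Σ (Fin n → Copy T F) λ C → (((i j : Fin n) → i ≢ j → EdgeDisjoint (C i) (C j))
                × ((v : Fin k) → Injective _≡_ _≡_ (λ i → φ (C i) v))
                × ((x : Fin n) → count (λ i → inCopy (C i) x) ≡ k))
lemma5 zero {{k≢0}} = ⊥-elim-irr (NonZero.nonZero k≢0)
lemma5 (suc k) n big T forest F mindeg =
  copy T F packing , copies-edge-disjoint T F packing , images-injective T F packing , copies-through T F packing
  where
  packing : PartialPacking T F (λ _ → true)
  packing = grow T F forest mindeg big k (λ _ → true) (count-true (suc k))
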